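{- Let $G=\circ(T_0,T_1,\dots,T_m)$ be a 2-tiled graph and let $C$ be a Hamiltonian cycle in $G$. For each $i$, let $C\cap T_i$ denote the subgraph of $G$ with vertex set $V(C)\cap V(T_i)$ and edge set $E(C)\cap E(T_i)$. Then: (1) $C=\bigcup_{i=0}^m (C\cap T_i)$; (2) for each $i$, $C\cap T_i$ is a union of (vertex-disjoint) paths and isolated vertices; (3) if $v$ is a vertex of $C\cap T_i$, then $v$ has degree $2$ in $C\cap T_i$ or $v$ is a wall vertex of $T_i$; (4) $C\cap T_i$ contains at most two distinct non-degenerate paths (paths with at least one edge) as components; (5) if $C\cap T_i$ consists of two distinct non-degenerate paths $P_1$ and $P_2$ (as components), then $C\cap T_i$ is exactly the disjoint union $P_1\oplus P_2$, i.e. it has no isolated vertices.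
   Context: A tile is a triple $T=(G,x,y)$ consisting of a graph $G$ and two sequences $x$ (left wall) and $y$ (right wall) of distinct vertices of $G$, with no vertex appearing in both; it is a $k$-tile if $|x|=|y|=k$. Vertices of $x$ and $y$ are wall vertices; other vertices are internal. The join $(G,x,y)\otimes(G',x',y')$ of tiles with $|y|=|x'|$ is the tile obtained from the disjoint union of $G$ and $G'$ by identifying $y$ term by term with $x'$, with left wall $x$ and right wall $y'$. For a tile $(G,x,y)$ with $|x|=|y|$, its cyclization is the graph obtained by identifying $x_j$ with $y_j$ for all $j$; $\circ(T_0,\dots,T_m)$ denotes the cyclization of $T_0\otimes\cdots\otimes T_m$. A $k$-tiled graph is the cyclization of a sequence of at least $k+1$ $k$-tiles; thus a 2-tiled graph $\circ(T_0,\dots,T_m)$ has $m\ge 2$, and each $T_i$ is regarded as a subgraph of $G$ (with the right wall of $T_i$ identified with the left wall of $T_{i+1}$, indices modulo $m+1$). -}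

module Defs where

open import Data.Nat using (ℕ; zero; suc; _≤_)
open import Data.Nat.DivMod using (_mod_)
open import Data.Fin using (Fin; zero; suc; toℕ; inject₁)
open import Data.Sum using (_⊎_; inj₁; inj₂)
open import Data.Product using (Σ; ∃; ∃-syntax; _×_; _,_; proj₁; proj₂)
open import Relation.Binary.PropositionalEquality using (_≡_; _≢_)
open import Relation.Nullary using (¬_)
open import Function using (_⇔_)

-- Finite multigraphs (edges are abstract, with an ordered pair of ends;
-- parallel edges are allowed, as produced by the join of tiles, which
-- takes a disjoint union before identifying wall vertices).

record Graph : Set₁ where
  field
    V    : Set
    E    : Set
    ends : E → V × V

endpoint : (G : Graph) → Fin 2 → Graph.E G → Graph.V G
endpoint G zero       e = proj₁ (Graph.ends G e)
endpoint G (suc zero) e = proj₂ (Graph.ends G e)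

Joins : (G : Graph) → Graph.E G → Graph.V G → Graph.V G → Set
Joins G e u w = (Graph.ends G e ≡ (u , w)) ⊎ (Graph.ends G e ≡ (w , u))

Inj : {A B : Set} → (A → B) → Set
Inj f = ∀ a b → f a ≡ f b → a ≡ b

next : {n : ℕ} → Fin (suc n) → Fin (suc n)
next {n} i = suc (toℕ i) mod (suc n)

record Subgraph (G : Graph) : Set₁ where
  field
    inV : Graph.V G → Set
    inE : Graph.E G → Set

SameSubgraph : {G : Graph} → Subgraph G → Subgraph G → Set
SameSubgraph H K =
  (∀ v → Subgraph.inV H v ⇔ Subgraph.inV K v) ×
  (∀ e → Subgraph.inE H e ⇔ Subgraph.inE K e)

⋃ : {G : Graph} {n : ℕ} → (Fin n → Subgraph G) → Subgraph G
⋃ {n = n} F = record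
  { inV = λ v → ∃[ i ] Subgraph.inV (F i) v
  ; inE = λ e → ∃[ i ] Subgraph.inE (F i) e }

-- v has degree d in H: the half-edges (edge of H, side) whose end is v
-- are in bijection with Fin d (so a loop counts twice).
HasDegree : {G : Graph} → Subgraph G → Graph.V G → ℕ → Set
HasDegree {G} H v d =
  Σ (Fin d → Graph.E G × Fin 2) λ f →
    (∀ k → Subgraph.inE H (proj₁ (f k)) × endpoint G (proj₂ (f k)) (proj₁ (f k)) ≡ v)
  × Inj f
  × (∀ e s → Subgraph.inE H e → endpoint G s e ≡ v → ∃[ k ] f k ≡ (e , s))

record Path {G : Graph} (H : Subgraph G) : Set where
  field
    len    : ℕ
    vs     : Fin (suc len) → Graph.V G
    es     : Fin len → Graph.E G
    vs-inj : Inj vs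
    es-inj : Inj es
    vs-in  : ∀ x → Subgraph.inV H (vs x)
    es-in  : ∀ k → Subgraph.inE H (es k)
    joins  : ∀ k → Joins G (es k) (vs (inject₁ k)) (vs (suc k))

NonDegenerate : {G : Graph} {H : Subgraph G} → Path H → Set
NonDegenerate P = 1 ≤ Path.len P

-- H is the union of the vertex-disjoint paths path 0 .. path (p-1)
-- (paths of length 0 being the isolated vertices).  The paths are then
-- exactly the connected components of H.
record PathDecomposition {G : Graph} (H : Subgraph G) : Set₁ where
  field
    p        : ℕ
    path     : Fin p → Path H
    disjoint : ∀ a b → a ≢ b → ∀ x y → Path.vs (path a) x ≢ Path.vs (path b) y
    coverV   : ∀ v → Subgraph.inV H v → ∃[ a ] ∃[ x ] Path.vs (path a) x ≡ v
    coverE   : ∀ e → Subgraph.inE H e → ∃[ a ] ∃[ k ] Path.es (path a) k ≡ e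

record HamCycle (G : Graph) : Set where
  field
    n       : ℕ                -- the cycle has suc n vertices
    n≥2     : 2 ≤ n
    vtx     : Fin (suc n) → Graph.V G
    vtx-inj : Inj vtx
    vtx-sur : ∀ v → ∃[ k ] vtx k ≡ v
    edg     : Fin (suc n) → Graph.E G
    edg-inj : Inj edg
    joins   : ∀ k → Joins G (edg k) (vtx k) (vtx (next k))

cycleSubgraph : {G : Graph} → HamCycle G → Subgraph G
cycleSubgraph C = record
  { inV = λ v → ∃[ k ] HamCycle.vtx C k ≡ v
  ; inE = λ e → ∃[ k ] HamCycle.edg C k ≡ e }

_∩_ : {G : Graph} → Subgraph G → Subgraph G → Subgraph G
H ∩ K = record
  { inV = λ v → Subgraph.inV H v × Subgraph.inV K v
  ; inE = λ e → Subgraph.inE H e × Subgraph.inE K e }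

-- Up to isomorphism, a 2-tile (G, x, y) has vertex set
-- {x₀, x₁} ⊎ (internal vertices) ⊎ {y₀, y₁}; we use this canonical form:
-- inj₁ j = x_j (left wall), inj₂ (inj₁ v) = internal, inj₂ (inj₂ j) = y_j.

TileV : ℕ → Set
TileV k = Fin 2 ⊎ (Fin k ⊎ Fin 2)

record Tile : Set where
  field
    nInt : ℕ
    nE   : ℕ
    ends : Fin nE → TileV nInt × TileV nInt

-- Vertices: the wall vertices
-- (i , j) = j-th vertex of the left wall of T_i (= right wall of T_{i-1},
-- indices mod m+1), and the internal vertices (i , v) of each T_i.

module _ (m : ℕ) (T : Fin (suc m) → Tile) where

  TiledV : Set
  TiledV = (Fin (suc m) × Fin 2) ⊎ Σ (Fin (suc m)) (λ i → Fin (Tile.nInt (T i)))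

  TiledE : Set
  TiledE = Σ (Fin (suc m)) (λ i → Fin (Tile.nE (T i)))

  embed : (i : Fin (suc m)) → TileV (Tile.nInt (T i)) → TiledV
  embed i (inj₁ j)        = inj₁ (i , j)
  embed i (inj₂ (inj₁ v)) = inj₂ (i , v)
  embed i (inj₂ (inj₂ j)) = inj₁ (next i , j)

  tiledGraph : Graph
  tiledGraph = record
    { V    = TiledV
    ; E    = TiledE
    ; ends = λ { (i , e) → embed i (proj₁ (Tile.ends (T i) e))
                         , embed i (proj₂ (Tile.ends (T i) e)) } }

  tileSubgraph : Fin (suc m) → Subgraph tiledGraph
  tileSubgraph i = record
    { inV = λ v → ∃[ u ] embed i u ≡ v
    ; inE = λ e → proj₁ e ≡ i }

  IsWallOf : Fin (suc m) → TiledV → Set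
  IsWallOf i v = ∃[ j ] ((v ≡ embed i (inj₁ j)) ⊎ (v ≡ embed i (inj₂ (inj₂ j))))

-- Cut the Hamiltonian cycle C at one of its edges that leaves Tᵢ; one exists because m ≥ 2, so C
-- visits the wall vertex x₀ of T_{i+2}, which is not in Tᵢ.  What remains is a Hamiltonian path, and
-- C ∩ Tᵢ is the union of the maximal runs of consecutive path edges lying in Tᵢ: vertex-disjoint paths.
-- An internal vertex of Tᵢ has both of its cycle edges in Tᵢ, so it has degree 2 in C ∩ Tᵢ and it is
-- not an end of any path in any path decomposition.  All path ends are thus among the four wall
-- vertices of Tᵢ; two non-degenerate paths already have four distinct ends, and a third path, even an
-- isolated vertex, would need a fifth.

module Submission where

open import Defs
open import Data.Nat using (ℕ; zero; suc; _+_; _∸_; _≤_; _<_; _%_; z≤n; s≤s; NonZero; _<?_)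
open import Data.Nat.Properties
  using ( +-comm; +-assoc; +-suc; +-identityʳ; m+[n∸m]≡n; 1+n≢0; n≮n; <⇒≤; <⇒≱; ≤-pred; ≤-trans; <-≤-trans
        ; ≤∧≢⇒<; m≤m+n; m<n⇒m<1+n; +-monoʳ-≤; +-cancelˡ-≡; +-cancelˡ-<; <-cmp)
open import Data.Nat.DivMod using (%-distribˡ-+; m%n%n≡m%n; [m+n]%n≡m%n; m<n⇒m%n≡m; m%n<n)
open import Data.Nat.GeneralisedArithmetic using (fold; fold-+)
open import Data.Fin using (Fin; zero; suc; toℕ; fromℕ; fromℕ<; inject₁; _≟_)
open import Data.Fin.Properties
  using (toℕ-fromℕ<; toℕ-injective; toℕ<n; toℕ-inject₁; fromℕ≢inject₁; suc-injective; injective⇒≤)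
open import Data.List using (List; []; _∷_; length; lookup; filter; upTo)
open import Data.List.Relation.Unary.All as All using (All; []; _∷_)
open import Data.List.Relation.Unary.AllPairs using ([]; _∷_)
open import Data.List.Relation.Unary.Any using (here; there; index)
open import Data.List.Relation.Unary.Any.Properties using (lookup-index)
open import Data.List.Relation.Unary.Unique.Propositional using (Unique)
open import Data.List.Relation.Unary.Unique.Propositional.Properties using (upTo⁺; filter⁺)
open import Data.List.Membership.Propositional using (_∈_)
open import Data.List.Membership.Propositional.Properties using (∈-filter⁺; ∈-filter⁻; ∈-upTo⁺; ∈-upTo⁻; ∈-lookup)
open import Data.Product using (∃-syntax; _×_; _,_; proj₁; proj₂)
open import Data.Product.Properties using (,-injectiveˡ)
open import Data.Sum using (_⊎_; inj₁; inj₂)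
open import Data.Sum.Properties using (inj₁-injective; inj₂-injective)
open import Data.Empty using (⊥; ⊥-elim)
open import Function using (mk⇔)
open import Relation.Nullary using (¬_; Dec; yes; no; ¬?)
open import Relation.Nullary.Decidable using (_×-dec_)
open import Relation.Binary.Definitions using (tri<; tri≈; tri>)
open import Relation.Binary.PropositionalEquality

[m%n+k]%n≡[m+k]%n : ∀ m k n .{{_ : NonZero n}} → (m % n + k) % n ≡ (m + k) % n
[m%n+k]%n≡[m+k]%n m k n = begin
  (m % n + k) % n            ≡⟨ %-distribˡ-+ (m % n) k n ⟩
  (m % n % n + k % n) % n    ≡⟨ cong (λ x → (x + k % n) % n) (m%n%n≡m%n m n) ⟩
  (m % n + k % n) % n        ≡⟨ %-distribˡ-+ m k n ⟨
  (m + k) % n                ∎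
  where open ≡-Reasoning

[k+m%n]%n≡[k+m]%n : ∀ k m n .{{_ : NonZero n}} → (k + m % n) % n ≡ (k + m) % n
[k+m%n]%n≡[k+m]%n k m n = begin
  (k + m % n) % n   ≡⟨ cong (_% n) (+-comm k (m % n)) ⟩
  (m % n + k) % n   ≡⟨ [m%n+k]%n≡[m+k]%n m k n ⟩
  (m + k) % n       ≡⟨ cong (_% n) (+-comm m k) ⟩
  (k + m) % n       ∎
  where open ≡-Reasoning

[k+m+[n∸k]]%n≡m%n : ∀ k m n .{{_ : NonZero n}} → k ≤ n → (k + m + (n ∸ k)) % n ≡ m % n
[k+m+[n∸k]]%n≡m%n k m n k≤n = begin
  (k + m + (n ∸ k)) % n    ≡⟨ cong (λ x → (x + (n ∸ k)) % n) (+-comm k m) ⟩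
  (m + k + (n ∸ k)) % n    ≡⟨ cong (_% n) (+-assoc m k (n ∸ k)) ⟩
  (m + (k + (n ∸ k))) % n  ≡⟨ cong (λ x → (m + x) % n) (m+[n∸m]≡n k≤n) ⟩
  (m + n) % n              ≡⟨ [m+n]%n≡m%n m n ⟩
  m % n                    ∎
  where open ≡-Reasoning

module _ {n : ℕ} where

  toℕ-fold-next : (k : Fin (suc n)) (t : ℕ) → toℕ (fold k next t) ≡ (toℕ k + t) % suc n
  toℕ-fold-next k zero = sym (begin
    (toℕ k + 0) % suc n  ≡⟨ cong (_% suc n) (+-identityʳ (toℕ k)) ⟩
    toℕ k % suc n        ≡⟨ m<n⇒m%n≡m (toℕ<n k) ⟩
    toℕ k                ∎)
    where open ≡-Reasoning
  toℕ-fold-next k (suc t) = begin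
    toℕ (next (fold k next t))           ≡⟨ toℕ-fromℕ< _ ⟩
    suc (toℕ (fold k next t)) % suc n    ≡⟨ cong (λ x → suc x % suc n) (toℕ-fold-next k t) ⟩
    (1 + (toℕ k + t) % suc n) % suc n    ≡⟨ [k+m%n]%n≡[k+m]%n 1 (toℕ k + t) (suc n) ⟩
    suc (toℕ k + t) % suc n              ≡⟨ cong (_% suc n) (+-suc (toℕ k) t) ⟨
    (toℕ k + suc t) % suc n              ∎
    where open ≡-Reasoning

  fold-next-injective : (k : Fin (suc n)) {t u : ℕ} → t < suc n → u < suc n →
                        fold k next t ≡ fold k next u → t ≡ u
  fold-next-injective k {t} {u} t<N u<N eq = begin
    t                                         ≡⟨ unrotate t t<N ⟨
    ((toℕ k + t) % N + (N ∸ toℕ k)) % N       ≡⟨ cong (λ x → (x + (N ∸ toℕ k)) % N) residues ⟩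
    ((toℕ k + u) % N + (N ∸ toℕ k)) % N       ≡⟨ unrotate u u<N ⟩
    u                                         ∎
    where
    open ≡-Reasoning
    N = suc n
    residues : (toℕ k + t) % N ≡ (toℕ k + u) % N
    residues = trans (sym (toℕ-fold-next k t)) (trans (cong toℕ eq) (toℕ-fold-next k u))
    unrotate : ∀ x → x < N → ((toℕ k + x) % N + (N ∸ toℕ k)) % N ≡ x
    unrotate x x<N = trans ([m%n+k]%n≡[m+k]%n (toℕ k + x) (N ∸ toℕ k) N)
                      (trans ([k+m+[n∸k]]%n≡m%n (toℕ k) x N (<⇒≤ (toℕ<n k))) (m<n⇒m%n≡m x<N))

  fold-next-surjective : (k k′ : Fin (suc n)) → ∃[ t ] t < suc n × fold k next t ≡ k′
  fold-next-surjective k k′ = t , m%n<n (toℕ k′ + (N ∸ toℕ k)) N , toℕ-injective (begin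
    toℕ (fold k next t)                       ≡⟨ toℕ-fold-next k t ⟩
    (toℕ k + (toℕ k′ + (N ∸ toℕ k)) % N) % N   ≡⟨ [k+m%n]%n≡[k+m]%n (toℕ k) _ N ⟩
    (toℕ k + (toℕ k′ + (N ∸ toℕ k))) % N       ≡⟨ cong (_% N) (+-assoc (toℕ k) (toℕ k′) _) ⟨
    (toℕ k + toℕ k′ + (N ∸ toℕ k)) % N         ≡⟨ [k+m+[n∸k]]%n≡m%n (toℕ k) (toℕ k′) N (<⇒≤ (toℕ<n k)) ⟩
    toℕ k′ % N                                 ≡⟨ m<n⇒m%n≡m (toℕ<n k′) ⟩
    toℕ k′                                     ∎)
    where
    open ≡-Reasoning
    N = suc n
    t = (toℕ k′ + (N ∸ toℕ k)) % N

  fold-next-period : (k : Fin (suc n)) → fold k next (suc n) ≡ k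
  fold-next-period k = toℕ-injective (begin
    toℕ (fold k next (suc n))   ≡⟨ toℕ-fold-next k (suc n) ⟩
    (toℕ k + suc n) % suc n     ≡⟨ [m+n]%n≡m%n (toℕ k) (suc n) ⟩
    toℕ k % suc n               ≡⟨ m<n⇒m%n≡m (toℕ<n k) ⟩
    toℕ k                       ∎)
    where open ≡-Reasoning

  prev : Fin (suc n) → Fin (suc n)
  prev k = fold k next n

  next-prev : (k : Fin (suc n)) → next (prev k) ≡ k
  next-prev = fold-next-period

  prev-next : (k : Fin (suc n)) → prev (next k) ≡ k
  prev-next k = begin
    fold (next k) next n  ≡⟨ fold-+ k next n {1} ⟨
    fold k next (n + 1)   ≡⟨ cong (fold k next) (+-comm n 1) ⟩
    fold k next (suc n)   ≡⟨ fold-next-period k ⟩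
    k                     ∎
    where open ≡-Reasoning

  next≢id : 1 ≤ n → (k : Fin (suc n)) → next k ≢ k
  next≢id 1≤n k eq = 1+n≢0 (fold-next-injective k (s≤s 1≤n) (s≤s z≤n) eq)

  next²≢id : 2 ≤ n → (k : Fin (suc n)) → next (next k) ≢ k
  next²≢id 2≤n k eq = 1+n≢0 (fold-next-injective k (s≤s 2≤n) (s≤s z≤n) eq)

lookup-injective : {A : Set} {xs : List A} → Unique xs → ∀ i j → lookup xs i ≡ lookup xs j → i ≡ j
lookup-injective (_ ∷ _)           zero    zero    _  = refl
lookup-injective (x≢xs ∷ _)        zero    (suc j) eq = ⊥-elim (All.lookup x≢xs (∈-lookup j) eq)
lookup-injective (x≢xs ∷ _)        (suc i) zero    eq = ⊥-elim (All.lookup x≢xs (∈-lookup i) (sym eq))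
lookup-injective (_ ∷ xs-unique)   (suc i) (suc j) eq = cong suc (lookup-injective xs-unique i j eq)

Unique⇒length≤ : {A : Set} {xs ys : List A} → Unique xs → (∀ {x} → x ∈ xs → x ∈ ys) → length xs ≤ length ys
Unique⇒length≤ {xs = xs} {ys} xs-unique xs⊆ys = injective⇒≤ position-injective
  where
  position : Fin (length xs) → Fin (length ys)
  position i = index (xs⊆ys (∈-lookup i))
  position-injective : ∀ {i j} → position i ≡ position j → i ≡ j
  position-injective {i} {j} eq = lookup-injective xs-unique i j (begin
    lookup xs i           ≡⟨ lookup-index (xs⊆ys (∈-lookup i)) ⟩
    lookup ys (position i) ≡⟨ cong (lookup ys) eq ⟩
    lookup ys (position j) ≡⟨ lookup-index (xs⊆ys (∈-lookup j)) ⟨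
    lookup xs j           ∎)
    where open ≡-Reasoning

other : Fin 2 → Fin 2
other zero       = suc zero
other (suc zero) = zero

≡-or-other : ∀ (s s₀ : Fin 2) → s ≡ s₀ ⊎ s ≡ other s₀
≡-or-other zero       zero       = inj₁ refl
≡-or-other zero       (suc zero) = inj₂ refl
≡-or-other (suc zero) zero       = inj₂ refl
≡-or-other (suc zero) (suc zero) = inj₁ refl

module _ (G : Graph) {e : Graph.E G} {u w : Graph.V G} where

  joinSide : Joins G e u w → Fin 2
  joinSide (inj₁ _) = zero
  joinSide (inj₂ _) = suc zero

  endpoint-joinSide : (J : Joins G e u w) → endpoint G (joinSide J) e ≡ u
  endpoint-joinSide (inj₁ eq) = cong proj₁ eq
  endpoint-joinSide (inj₂ eq) = cong proj₂ eq

  endpoint-other-joinSide : (J : Joins G e u w) → endpoint G (other (joinSide J)) e ≡ w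
  endpoint-other-joinSide (inj₁ eq) = cong proj₂ eq
  endpoint-other-joinSide (inj₂ eq) = cong proj₁ eq

  Joins⇒endpoint : Joins G e u w → ∀ s → endpoint G s e ≡ u ⊎ endpoint G s e ≡ w
  Joins⇒endpoint J s with ≡-or-other s (joinSide J)
  ... | inj₁ refl = inj₁ (endpoint-joinSide J)
  ... | inj₂ refl = inj₂ (endpoint-other-joinSide J)

module _ {G : Graph} (H : Subgraph G) (v : Graph.V G) where

  HalfEdgeAt : Graph.E G × Fin 2 → Set
  HalfEdgeAt h = Subgraph.inE H (proj₁ h) × endpoint G (proj₂ h) (proj₁ h) ≡ v

  degree-two : ∀ h₁ h₂ → HalfEdgeAt h₁ → HalfEdgeAt h₂ → h₁ ≢ h₂ →
               (∀ h → HalfEdgeAt h → h ≡ h₁ ⊎ h ≡ h₂) → HasDegree H v 2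
  degree-two h₁ h₂ at₁ at₂ h₁≢h₂ only = half , half-at , half-injective , half-surjective
    where
    half : Fin 2 → Graph.E G × Fin 2
    half zero       = h₁
    half (suc zero) = h₂
    half-at : ∀ k → HalfEdgeAt (half k)
    half-at zero       = at₁
    half-at (suc zero) = at₂
    half-injective : Inj half
    half-injective zero       zero       _  = refl
    half-injective zero       (suc zero) eq = ⊥-elim (h₁≢h₂ eq)
    half-injective (suc zero) zero       eq = ⊥-elim (h₁≢h₂ (sym eq))
    half-injective (suc zero) (suc zero) _  = refl
    half-surjective : ∀ e s → Subgraph.inE H e → endpoint G s e ≡ v → ∃[ k ] half k ≡ (e , s)
    half-surjective e s e∈H at with only (e , s) (e∈H , at)
    ... | inj₁ eq = zero , sym eq
    ... | inj₂ eq = suc zero , sym eq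

Adjacent : {ℓ : ℕ} → Fin ℓ → Fin (suc ℓ) → Set
Adjacent k x = inject₁ k ≡ x ⊎ suc k ≡ x

end : (ℓ : ℕ) → Fin 2 → Fin (suc ℓ)
end ℓ zero       = zero
end ℓ (suc zero) = fromℕ ℓ

Adjacent-end-unique : ∀ {ℓ} s {k₁ k₂ : Fin ℓ} → Adjacent k₁ (end ℓ s) → Adjacent k₂ (end ℓ s) → k₁ ≡ k₂
Adjacent-end-unique zero       {zero} {zero} _ _ = refl
Adjacent-end-unique zero       (inj₂ ()) _
Adjacent-end-unique zero       _ (inj₂ ())
Adjacent-end-unique (suc zero) (inj₁ eq) _ = ⊥-elim (fromℕ≢inject₁ (sym eq))
Adjacent-end-unique (suc zero) _ (inj₁ eq) = ⊥-elim (fromℕ≢inject₁ (sym eq))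
Adjacent-end-unique (suc zero) (inj₂ eq₁) (inj₂ eq₂) = suc-injective (trans eq₁ (sym eq₂))

module _ {G : Graph} {H : Subgraph G} where

  pathEnd : Path H → Fin 2 → Graph.V G
  pathEnd P s = Path.vs P (end (Path.len P) s)

  NonDegenerate⇒pathEnds-distinct : (P : Path H) → NonDegenerate P → pathEnd P zero ≢ pathEnd P (suc zero)
  NonDegenerate⇒pathEnds-distinct P 1≤len eq with Path.len P | Path.vs-inj P _ _ eq
  ... | suc _ | ()

  edge-endpoint : (P : Path H) (k : Fin (Path.len P)) (s : Fin 2) →
                  ∃[ y ] endpoint G s (Path.es P k) ≡ Path.vs P y × Adjacent k y
  edge-endpoint P k s with Joins⇒endpoint G (Path.joins P k) s
  ... | inj₁ eq = inject₁ k , eq , inj₁ refl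
  ... | inj₂ eq = suc k , eq , inj₂ refl

module _ {G : Graph} {H : Subgraph G} (D : PathDecomposition H) where
  open PathDecomposition D

  incident-edge : ∀ a x (h : Graph.E G × Fin 2) → HalfEdgeAt H (Path.vs (path a) x) h →
                  ∃[ k ] Path.es (path a) k ≡ proj₁ h × Adjacent k x
  incident-edge a x (e , s) (e∈H , at) with coverE e e∈H
  ... | d , k , refl with edge-endpoint (path d) k s | d ≟ a
  ... | y , end≡ , _   | no d≢a   = ⊥-elim (disjoint a d (≢-sym d≢a) x y (trans (sym at) end≡))
  ... | y , end≡ , adj | yes refl =
    k , refl , subst (Adjacent k) (Path.vs-inj (path a) y x (trans (sym end≡) at)) adj

  pathEnd-edge-unique : ∀ a s h₁ h₂ → HalfEdgeAt H (pathEnd (path a) s) h₁ → HalfEdgeAt H (pathEnd (path a) s) h₂ →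
                        proj₁ h₁ ≡ proj₁ h₂
  pathEnd-edge-unique a s h₁ h₂ at₁ at₂ with incident-edge a _ h₁ at₁ | incident-edge a _ h₂ at₂
  ... | k₁ , refl , adj₁ | k₂ , refl , adj₂ = cong (Path.es (path a)) (Adjacent-end-unique s adj₁ adj₂)

record IndexedPath (G : Graph) : Set where
  field
    len              : ℕ
    vertex           : ℕ → Graph.V G
    edge             : ℕ → Graph.E G
    vertex-injective : ∀ {t u} → t ≤ len → u ≤ len → vertex t ≡ vertex u → t ≡ u
    edge-injective   : ∀ {t u} → t < len → u < len → edge t ≡ edge u → t ≡ u
    joins            : ∀ {t} → t < len → Joins G (edge t) (vertex t) (vertex (suc t))

record LiesOn {G : Graph} (W : IndexedPath G) (H : Subgraph G) : Set where
  field
    vertex?   : ∀ t → Dec (Subgraph.inV H (IndexedPath.vertex W t))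
    edge?     : ∀ t → Dec (Subgraph.inE H (IndexedPath.edge W t))
    vertex-on : ∀ v → Subgraph.inV H v → ∃[ t ] t ≤ IndexedPath.len W × IndexedPath.vertex W t ≡ v
    edge-on   : ∀ e → Subgraph.inE H e → ∃[ t ] t < IndexedPath.len W × IndexedPath.edge W t ≡ e
    edge-ends : ∀ {t} → t < IndexedPath.len W → Subgraph.inE H (IndexedPath.edge W t) →
                Subgraph.inV H (IndexedPath.vertex W t) × Subgraph.inV H (IndexedPath.vertex W (suc t))

module Runs {G : Graph} {H : Subgraph G} {W : IndexedPath G} (on : LiesOn W H) where
  open IndexedPath W
  open LiesOn on

  InV : ℕ → Set
  InV t = Subgraph.inV H (vertex t)

  InE : ℕ → Set
  InE t = t < len × Subgraph.inE H (edge t)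

  InE? : ∀ t → Dec (InE t)
  InE? t = (t <? len) ×-dec edge? t

  runLength : (fuel t : ℕ) → ℕ
  runLength zero       t = 0
  runLength (suc fuel) t with InE? t
  ... | yes _ = suc (runLength fuel (suc t))
  ... | no  _ = 0

  runLength-InE : ∀ fuel t k → k < runLength fuel t → InE (t + k)
  runLength-InE (suc fuel) t k k< with InE? t
  runLength-InE (suc fuel) t zero    _         | yes t∈ = subst InE (sym (+-identityʳ t)) t∈
  runLength-InE (suc fuel) t (suc k) (s≤s k<)  | yes _  = subst InE (sym (+-suc t k)) (runLength-InE fuel (suc t) k k<)

  runLength-maximal : ∀ fuel t → len ≤ fuel + t → ¬ InE (t + runLength fuel t)
  runLength-maximal zero       t len≤t t∈ = <⇒≱ (subst (_< len) (+-identityʳ t) (proj₁ t∈)) len≤t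
  runLength-maximal (suc fuel) t len≤ with InE? t
  ... | yes _  = λ t+r∈ → runLength-maximal fuel (suc t) (subst (len ≤_) (sym (+-suc fuel t)) len≤)
                                              (subst InE (+-suc t _) t+r∈)
  ... | no t∉ = λ t+0∈ → t∉ (subst InE (+-identityʳ t) t+0∈)

  runLength-bound : ∀ fuel t → t ≤ len → t + runLength fuel t ≤ len
  runLength-bound zero       t t≤len = subst (_≤ len) (sym (+-identityʳ t)) t≤len
  runLength-bound (suc fuel) t t≤len with InE? t
  ... | yes t∈ = subst (_≤ len) (sym (+-suc t _)) (runLength-bound fuel (suc t) (proj₁ t∈))
  ... | no _   = subst (_≤ len) (sym (+-identityʳ t)) t≤len

  runLen : ℕ → ℕ
  runLen s = runLength len s

  InE⇒<runLen : ∀ s x → x ≤ runLen s → InE (s + x) → x < runLen s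
  InE⇒<runLen s x x≤ s+x∈ =
    ≤∧≢⇒< x≤ (λ x≡ → runLength-maximal len s (m≤m+n len s) (subst (λ y → InE (s + y)) x≡ s+x∈))

  RunStart : ℕ → Set
  RunStart zero    = InV 0
  RunStart (suc s) = InV (suc s) × ¬ InE s

  RunStart? : ∀ s → Dec (RunStart s)
  RunStart? zero    = vertex? 0
  RunStart? (suc s) = vertex? (suc s) ×-dec ¬? (InE? s)

  RunStart⇒InV : ∀ s → RunStart s → InV s
  RunStart⇒InV zero    start = start
  RunStart⇒InV (suc s) start = proj₁ start

  module _ (s : ℕ) (start : RunStart s) (s≤len : s ≤ len) where

    run-bound : (x : Fin (suc (runLen s))) → s + toℕ x ≤ len
    run-bound x = ≤-trans (+-monoʳ-≤ s (≤-pred (toℕ<n x))) (runLength-bound len s s≤len)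

    run-InV : ∀ x → x ≤ runLen s → InV (s + x)
    run-InV zero    _  = subst InV (sym (+-identityʳ s)) (RunStart⇒InV s start)
    run-InV (suc x) x< = subst InV (sym (+-suc s x)) (proj₂ (edge-ends (proj₁ s+x∈) (proj₂ s+x∈)))
      where s+x∈ = runLength-InE len s x x<

    run : Path H
    run = record
      { len    = runLen s
      ; vs     = λ x → vertex (s + toℕ x)
      ; es     = λ k → edge (s + toℕ k)
      ; vs-inj = λ x y eq → toℕ-injective (+-cancelˡ-≡ s _ _ (vertex-injective (run-bound x) (run-bound y) eq))
      ; es-inj = λ k l eq → toℕ-injective (+-cancelˡ-≡ s _ _
                   (edge-injective (proj₁ (InE-at k)) (proj₁ (InE-at l)) eq))
      ; vs-in  = λ x → run-InV (toℕ x) (≤-pred (toℕ<n x))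
      ; es-in  = λ k → proj₂ (InE-at k)
      ; joins  = λ k → subst₂ (Joins G (edge (s + toℕ k)))
                   (cong (λ y → vertex (s + y)) (sym (toℕ-inject₁ k)))
                   (cong vertex (sym (+-suc s (toℕ k))))
                   (joins (proj₁ (InE-at k)))
      }
      where
      InE-at : (k : Fin (runLen s)) → InE (s + toℕ k)
      InE-at k = runLength-InE len s (toℕ k) (toℕ<n k)

  runs-disjoint : ∀ s₁ s₂ x₁ → s₁ < s₂ → RunStart s₂ → s₂ ≤ s₁ + x₁ → x₁ ≤ runLen s₁ → ⊥
  runs-disjoint s₁ (suc s₂) x₁ (s≤s s₁≤s₂) (_ , s₂∉) s₂<s₁+x₁ x₁≤ =
    s₂∉ (subst InE (m+[n∸m]≡n s₁≤s₂) (runLength-InE len s₁ (s₂ ∸ s₁) (<-≤-trans k<x₁ x₁≤)))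
    where
    k<x₁ : s₂ ∸ s₁ < x₁
    k<x₁ = +-cancelˡ-< s₁ _ x₁ (subst (_< s₁ + x₁) (sym (m+[n∸m]≡n s₁≤s₂)) s₂<s₁+x₁)

  RunStart-unique : ∀ s₁ s₂ x₁ x₂ → RunStart s₁ → RunStart s₂ → x₁ ≤ runLen s₁ → x₂ ≤ runLen s₂ →
                    s₁ + x₁ ≡ s₂ + x₂ → s₁ ≡ s₂
  RunStart-unique s₁ s₂ x₁ x₂ start₁ start₂ x₁≤ x₂≤ eq with <-cmp s₁ s₂
  ... | tri< lt _ _ = ⊥-elim (runs-disjoint s₁ s₂ x₁ lt start₂ (subst (s₂ ≤_) (sym eq) (m≤m+n s₂ x₂)) x₁≤)
  ... | tri≈ _ s₁≡s₂ _ = s₁≡s₂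
  ... | tri> _ _ gt = ⊥-elim (runs-disjoint s₂ s₁ x₂ gt start₁ (subst (s₁ ≤_) eq (m≤m+n s₁ x₁)) x₂≤)

  enclosingRun : ∀ t → InV t → ∃[ s ] ∃[ x ] s + x ≡ t × RunStart s × x ≤ runLen s
  enclosingRun zero    0∈ = 0 , 0 , refl , 0∈ , z≤n
  enclosingRun (suc t) t+1∈ with InE? t
  ... | no t∉  = suc t , 0 , +-identityʳ _ , (t+1∈ , t∉) , z≤n
  ... | yes t∈ with enclosingRun t (proj₁ (edge-ends (proj₁ t∈) (proj₂ t∈)))
  ...   | s , x , refl , start , x≤ = s , suc x , +-suc s x , start , InE⇒<runLen s x x≤ t∈

  starts : List ℕ
  starts = filter RunStart? (upTo (suc len))

  startOf : Fin (length starts) → ℕ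
  startOf = lookup starts

  startOf-RunStart : ∀ a → RunStart (startOf a)
  startOf-RunStart a = proj₂ (∈-filter⁻ RunStart? {xs = upTo (suc len)} (∈-lookup a))

  startOf≤len : ∀ a → startOf a ≤ len
  startOf≤len a = ≤-pred (∈-upTo⁻ (proj₁ (∈-filter⁻ RunStart? {xs = upTo (suc len)} (∈-lookup a))))

  path : Fin (length starts) → Path H
  path a = run (startOf a) (startOf-RunStart a) (startOf≤len a)

  locate : ∀ t → t ≤ len → InV t → ∃[ a ] ∃[ x ] startOf a + x ≡ t × x ≤ runLen (startOf a)
  locate t t≤len t∈ with enclosingRun t t∈
  ... | s , x , refl , start , x≤ = index s∈ , x , cong (_+ x) (sym s≡) , subst (λ y → x ≤ runLen y) s≡ x≤
    where
    s∈ : s ∈ starts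
    s∈ = ∈-filter⁺ RunStart? (∈-upTo⁺ (s≤s (≤-trans (m≤m+n s x) t≤len))) start
    s≡ : s ≡ startOf (index s∈)
    s≡ = lookup-index s∈

  runsDecomposition : PathDecomposition H
  runsDecomposition = record
    { p        = length starts
    ; path     = path
    ; disjoint = disjoint
    ; coverV   = coverV
    ; coverE   = coverE
    }
    where
    disjoint : ∀ a b → a ≢ b → ∀ x y → Path.vs (path a) x ≢ Path.vs (path b) y
    disjoint a b a≢b x y eq = a≢b (lookup-injective (filter⁺ RunStart? (upTo⁺ (suc len))) a b
      (RunStart-unique _ _ (toℕ x) (toℕ y) (startOf-RunStart a) (startOf-RunStart b)
        (≤-pred (toℕ<n x)) (≤-pred (toℕ<n y))
        (vertex-injective (run-bound _ (startOf-RunStart a) (startOf≤len a) x)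
                          (run-bound _ (startOf-RunStart b) (startOf≤len b) y) eq)))

    coverV : ∀ v → Subgraph.inV H v → ∃[ a ] ∃[ x ] Path.vs (path a) x ≡ v
    coverV v v∈ with vertex-on v v∈
    ... | t , t≤len , refl with locate t t≤len v∈
    ...   | a , x , refl , x≤ = a , fromℕ< (s≤s x≤) , cong (λ y → vertex (startOf a + y)) (toℕ-fromℕ< (s≤s x≤))

    coverE : ∀ e → Subgraph.inE H e → ∃[ a ] ∃[ k ] Path.es (path a) k ≡ e
    coverE e e∈ with edge-on e e∈
    ... | t , t<len , refl with locate t (<⇒≤ t<len) (proj₁ (edge-ends t<len e∈))
    ...   | a , x , refl , x≤ = a , fromℕ< x< , cong (λ y → edge (startOf a + y)) (toℕ-fromℕ< x<)
      where
      x< : x < runLen (startOf a)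
      x< = InE⇒<runLen (startOf a) x x≤ (t<len , e∈)

LiesOn⇒PathDecomposition : {G : Graph} {H : Subgraph G} {W : IndexedPath G} → LiesOn W H → PathDecomposition H
LiesOn⇒PathDecomposition on = Runs.runsDecomposition on

EdgeClosed : {G : Graph} → Subgraph G → Set
EdgeClosed {G} K = ∀ {e u w} → Joins G e u w → Subgraph.inE K e → Subgraph.inV K u × Subgraph.inV K w

module _ {G : Graph} (C : HamCycle G) where
  open HamCycle C

  cutAt : Fin (suc n) → IndexedPath G
  cutAt k = record
    { len              = n
    ; vertex           = λ t → vtx (fold (next k) next t)
    ; edge             = λ t → edg (fold (next k) next t)
    ; vertex-injective = λ t≤n u≤n eq →
        fold-next-injective (next k) (s≤s t≤n) (s≤s u≤n) (vtx-inj _ _ eq)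
    ; edge-injective   = λ t<n u<n eq →
        fold-next-injective (next k) (m<n⇒m<1+n t<n) (m<n⇒m<1+n u<n) (edg-inj _ _ eq)
    ; joins            = λ {t} _ → joins (fold (next k) next t)
    }

  cutAt-LiesOn : (K : Subgraph G) (k : Fin (suc n)) →
                 (∀ v → Dec (Subgraph.inV K v)) → (∀ e → Dec (Subgraph.inE K e)) → EdgeClosed K →
                 ¬ Subgraph.inE K (edg k) → LiesOn (cutAt k) (cycleSubgraph C ∩ K)
  cutAt-LiesOn K k inV? inE? closed edg-k∉K = record
    { vertex?   = λ t → yes (_ , refl) ×-dec inV? _
    ; edge?     = λ t → yes (_ , refl) ×-dec inE? _
    ; vertex-on = vertex-on
    ; edge-on   = edge-on
    ; edge-ends = λ {t} _ (_ , e∈K) → let u∈K , w∈K = closed (joins _) e∈K in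
                                      ((_ , refl) , u∈K) , ((_ , refl) , w∈K)
    }
    where
    vertex-on : ∀ v → Subgraph.inV (cycleSubgraph C ∩ K) v → ∃[ t ] t ≤ n × vtx (fold (next k) next t) ≡ v
    vertex-on _ ((k′ , refl) , _) with fold-next-surjective (next k) k′
    ... | t , t<1+n , eq = t , ≤-pred t<1+n , cong vtx eq

    -- Position n of the cut path is vtx k again, whose outgoing edge edg k is not in K.
    edge-on : ∀ e → Subgraph.inE (cycleSubgraph C ∩ K) e → ∃[ t ] t < n × edg (fold (next k) next t) ≡ e
    edge-on _ ((k′ , refl) , e∈K) with fold-next-surjective (next k) k′
    ... | t , t<1+n , eq = t , ≤∧≢⇒< (≤-pred t<1+n) t≢n , cong edg eq
      where
      t≢n : t ≢ n
      t≢n refl = edg-k∉K (subst (λ j → Subgraph.inE K (edg j)) (trans (sym eq) (prev-next k)) e∈K)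

  private
    1≤n : 1 ≤ n
    1≤n = ≤-trans (s≤s z≤n) n≥2

  edg≢edg-prev : ∀ k → edg k ≢ edg (prev k)
  edg≢edg-prev k eq = next≢id 1≤n (prev k) (trans (next-prev k) (edg-inj _ _ eq))

  side : Fin (suc n) → Fin 2
  side k = joinSide G (joins k)

  outHalf inHalf : Fin (suc n) → Graph.E G × Fin 2
  outHalf k = edg k , side k
  inHalf  k = edg (prev k) , other (side (prev k))

  outHalf-at : ∀ k → endpoint G (side k) (edg k) ≡ vtx k
  outHalf-at k = endpoint-joinSide G (joins k)

  inHalf-at : ∀ k → endpoint G (other (side (prev k))) (edg (prev k)) ≡ vtx k
  inHalf-at k = trans (endpoint-other-joinSide G (joins (prev k))) (cong vtx (next-prev k))

  halfEdge-at-vtx : ∀ k k′ s → endpoint G s (edg k′) ≡ vtx k →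
                    (edg k′ , s) ≡ outHalf k ⊎ (edg k′ , s) ≡ inHalf k
  halfEdge-at-vtx k k′ s at with ≡-or-other s (side k′)
  ... | inj₁ refl with vtx-inj k′ k (trans (sym (outHalf-at k′)) at)
  ...   | refl = inj₁ refl
  halfEdge-at-vtx k k′ s at | inj₂ refl
    with vtx-inj (next k′) k (trans (sym (endpoint-other-joinSide G (joins k′))) at)
  ...   | refl = inj₂ (cong (λ j → edg j , other (side j)) (sym (prev-next k′)))

  module _ (K : Subgraph G) where

    cycle∩-degree-two : ∀ {k} → Subgraph.inE K (edg k) → Subgraph.inE K (edg (prev k)) →
                        HasDegree (cycleSubgraph C ∩ K) (vtx k) 2
    cycle∩-degree-two {k} out∈K in∈K =
      degree-two (cycleSubgraph C ∩ K) (vtx k) (outHalf k) (inHalf k)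
        (((k , refl) , out∈K) , outHalf-at k) (((prev k , refl) , in∈K) , inHalf-at k)
        (λ eq → edg≢edg-prev k (cong proj₁ eq)) only
      where
      only : ∀ h → HalfEdgeAt (cycleSubgraph C ∩ K) (vtx k) h → h ≡ outHalf k ⊎ h ≡ inHalf k
      only (_ , s) (((k′ , refl) , _) , at) = halfEdge-at-vtx k k′ s at

    pathEnd-cycleEdges∉ : (D : PathDecomposition (cycleSubgraph C ∩ K)) → ∀ a s {k} →
                          pathEnd (PathDecomposition.path D a) s ≡ vtx k →
                          Subgraph.inE K (edg k) → Subgraph.inE K (edg (prev k)) → ⊥
    pathEnd-cycleEdges∉ D a s {k} end≡ out∈K in∈K = edg≢edg-prev k
      (pathEnd-edge-unique D a s (outHalf k) (inHalf k)
        (((k , refl) , out∈K) , trans (outHalf-at k) (sym end≡))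
        (((prev k , refl) , in∈K) , trans (inHalf-at k) (sym end≡)))

module _ (m : ℕ) (T : Fin (suc m) → Tile) where

  tiles-cover : ∀ v → ∃[ i ] Subgraph.inV (tileSubgraph m T i) v
  tiles-cover (inj₁ (i , j)) = i , inj₁ j , refl
  tiles-cover (inj₂ (i , x)) = i , inj₂ (inj₁ x) , refl

  SameSubgraph-⋃-∩-tiles : (S : Subgraph (tiledGraph m T)) → SameSubgraph S (⋃ (λ i → S ∩ tileSubgraph m T i))
  SameSubgraph-⋃-∩-tiles S =
      (λ v → mk⇔ (λ v∈S → let i , v∈Tᵢ = tiles-cover v in i , v∈S , v∈Tᵢ) (λ (_ , v∈S , _) → v∈S))
    , (λ e → mk⇔ (λ e∈S → proj₁ e , e∈S , refl) (λ (_ , e∈S , _) → e∈S))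

  module _ (i : Fin (suc m)) where

    inTile? : ∀ v → Dec (Subgraph.inV (tileSubgraph m T i) v)
    inTile? (inj₁ (i′ , j)) with i′ ≟ i | i′ ≟ next i
    ... | yes refl | _        = yes (inj₁ j , refl)
    ... | no _     | yes refl = yes (inj₂ (inj₂ j) , refl)
    ... | no i′≢i  | no i′≢i⁺ = no λ
      { (inj₁ _ , eq)         → i′≢i (sym (,-injectiveˡ (inj₁-injective eq)))
      ; (inj₂ (inj₂ _) , eq)  → i′≢i⁺ (sym (,-injectiveˡ (inj₁-injective eq))) }
    inTile? (inj₂ (i′ , x)) with i′ ≟ i
    ... | yes refl = yes (inj₂ (inj₁ x) , refl)
    ... | no i′≢i  = no λ { (inj₂ (inj₁ _) , eq) → i′≢i (sym (,-injectiveˡ (inj₂-injective eq))) }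

    inTileEdge? : ∀ e → Dec (Subgraph.inE (tileSubgraph m T i) e)
    inTileEdge? e = proj₁ e ≟ i

    tile-EdgeClosed : EdgeClosed (tileSubgraph m T i)
    tile-EdgeClosed {_ , _} (inj₁ refl) refl = (_ , refl) , (_ , refl)
    tile-EdgeClosed {_ , _} (inj₂ refl) refl = (_ , refl) , (_ , refl)

    embed≡internal : ∀ {i′ x} u → embed m T i′ u ≡ inj₂ (i , x) → i′ ≡ i
    embed≡internal (inj₂ (inj₁ _)) eq = ,-injectiveˡ (inj₂-injective eq)

    internal-edge-in-tile : ∀ {e x} s → endpoint (tiledGraph m T) s e ≡ inj₂ (i , x) → proj₁ e ≡ i
    internal-edge-in-tile zero       eq = embed≡internal _ eq
    internal-edge-in-tile (suc zero) eq = embed≡internal _ eq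

    walls : List (TiledV m T)
    walls = inj₁ (i , zero) ∷ inj₁ (i , suc zero) ∷ inj₁ (next i , zero) ∷ inj₁ (next i , suc zero) ∷ []

    IsWallOf⇒∈walls : ∀ {v} → IsWallOf m T i v → v ∈ walls
    IsWallOf⇒∈walls (zero     , inj₁ refl) = here refl
    IsWallOf⇒∈walls (suc zero , inj₁ refl) = there (here refl)
    IsWallOf⇒∈walls (zero     , inj₂ refl) = there (there (here refl))
    IsWallOf⇒∈walls (suc zero , inj₂ refl) = there (there (there (here refl)))

    far-wall∉tile : 2 ≤ m → ¬ Subgraph.inV (tileSubgraph m T i) (inj₁ (next (next i) , zero))
    far-wall∉tile 2≤m (inj₁ _ , eq)        = next²≢id 2≤m i (sym (,-injectiveˡ (inj₁-injective eq)))
    far-wall∉tile 2≤m (inj₂ (inj₂ _) , eq) =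
      next≢id (≤-trans (s≤s z≤n) 2≤m) (next i) (sym (,-injectiveˡ (inj₁-injective eq)))

module _ (m : ℕ) (m≥2 : 2 ≤ m) (T : Fin (suc m) → Tile) (C : HamCycle (tiledGraph m T)) (i : Fin (suc m)) where
  open HamCycle C

  private
    Tᵢ : Subgraph (tiledGraph m T)
    Tᵢ = tileSubgraph m T i

    H : Subgraph (tiledGraph m T)
    H = cycleSubgraph C ∩ Tᵢ

  cycleEdge∉tile : ∃[ k ] ¬ Subgraph.inE Tᵢ (edg k)
  cycleEdge∉tile with vtx-sur (inj₁ (next (next i) , zero))
  ... | k , vtx≡ = k , λ edg-k∈Tᵢ →
    far-wall∉tile m T i m≥2 (subst (Subgraph.inV Tᵢ) vtx≡ (proj₁ (tile-EdgeClosed m T i (joins k) edg-k∈Tᵢ)))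

  cycle∩tile-decomposition : PathDecomposition H
  cycle∩tile-decomposition with cycleEdge∉tile
  ... | k₀ , k₀∉Tᵢ = LiesOn⇒PathDecomposition
    (cutAt-LiesOn C Tᵢ k₀ (inTile? m T i) (inTileEdge? m T i) (tile-EdgeClosed m T i) k₀∉Tᵢ)

  wall-or-inner : ∀ v → Subgraph.inV H v →
                  IsWallOf m T i v ⊎ ∃[ k ] vtx k ≡ v × Subgraph.inE Tᵢ (edg k) × Subgraph.inE Tᵢ (edg (prev k))
  wall-or-inner _ (_ , inj₁ j , refl)                 = inj₁ (j , inj₁ refl)
  wall-or-inner _ (_ , inj₂ (inj₂ j) , refl)          = inj₁ (j , inj₂ refl)
  wall-or-inner _ ((k , vtx≡) , inj₂ (inj₁ _) , refl) = inj₂ (k , vtx≡ ,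
    internal-edge-in-tile m T i (side C k) (trans (outHalf-at C k) vtx≡) ,
    internal-edge-in-tile m T i (other (side C (prev k))) (trans (inHalf-at C k) vtx≡))

  degree-two-or-wall : ∀ v → Subgraph.inV H v → HasDegree H v 2 ⊎ IsWallOf m T i v
  degree-two-or-wall v v∈H with wall-or-inner v v∈H
  ... | inj₁ wall                          = inj₂ wall
  ... | inj₂ (k , refl , out∈Tᵢ , in∈Tᵢ) = inj₁ (cycle∩-degree-two C Tᵢ out∈Tᵢ in∈Tᵢ)

  module _ (D : PathDecomposition H) where
    open PathDecomposition D

    pathEnd-IsWallOf : ∀ a s → IsWallOf m T i (pathEnd (path a) s)
    pathEnd-IsWallOf a s with wall-or-inner _ (Path.vs-in (path a) (end (Path.len (path a)) s))
    ... | inj₁ wall                            = wall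
    ... | inj₂ (k , vtx≡ , out∈Tᵢ , in∈Tᵢ) =
      ⊥-elim (pathEnd-cycleEdges∉ C Tᵢ D a s (sym vtx≡) out∈Tᵢ in∈Tᵢ)

    no-third-path : ∀ a b c → a ≢ b → a ≢ c → b ≢ c → NonDegenerate (path a) → NonDegenerate (path b) → ⊥
    no-third-path a b c a≢b a≢c b≢c a-nondeg b-nondeg =
      n≮n 4 (Unique⇒length≤ ends-distinct (λ v∈ends → IsWallOf⇒∈walls m T i (All.lookup ends-walls v∈ends)))
      where
      ends : List (TiledV m T)
      ends = pathEnd (path a) zero ∷ pathEnd (path a) (suc zero) ∷
             pathEnd (path b) zero ∷ pathEnd (path b) (suc zero) ∷ pathEnd (path c) zero ∷ []
      ends-walls : All (IsWallOf m T i) ends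
      ends-walls = pathEnd-IsWallOf a zero ∷ pathEnd-IsWallOf a (suc zero) ∷
                   pathEnd-IsWallOf b zero ∷ pathEnd-IsWallOf b (suc zero) ∷ pathEnd-IsWallOf c zero ∷ []
      ends-distinct : Unique ends
      ends-distinct =
          ( NonDegenerate⇒pathEnds-distinct (path a) a-nondeg
          ∷ disjoint a b a≢b _ _ ∷ disjoint a b a≢b _ _ ∷ disjoint a c a≢c _ _ ∷ [])
        ∷ (disjoint a b a≢b _ _ ∷ disjoint a b a≢b _ _ ∷ disjoint a c a≢c _ _ ∷ [])
        ∷ (NonDegenerate⇒pathEnds-distinct (path b) b-nondeg ∷ disjoint b c b≢c _ _ ∷ [])
        ∷ (disjoint b c b≢c _ _ ∷ [])
        ∷ []
        ∷ []

    two-paths⇒all-NonDegenerate : ∀ a b → a ≢ b → NonDegenerate (path a) → NonDegenerate (path b) →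
                                  ∀ c → NonDegenerate (path c)
    two-paths⇒all-NonDegenerate a b a≢b a-nondeg b-nondeg c with c ≟ a | c ≟ b
    ... | yes refl | _        = a-nondeg
    ... | no _     | yes refl = b-nondeg
    ... | no c≢a   | no c≢b   = ⊥-elim (no-third-path a b c a≢b (≢-sym c≢a) (≢-sym c≢b) a-nondeg b-nondeg)

lemma6 : (m : ℕ) → 2 ≤ m → (T : Fin (suc m) → Tile) → (C : HamCycle (tiledGraph m T)) →
    SameSubgraph (cycleSubgraph C) (⋃ (λ i → cycleSubgraph C ∩ tileSubgraph m T i))
    × (∀ i →
        PathDecomposition (cycleSubgraph C ∩ tileSubgraph m T i)
        × (∀ v → Subgraph.inV (cycleSubgraph C ∩ tileSubgraph m T i) v →
             HasDegree (cycleSubgraph C ∩ tileSubgraph m T i) v 2 ⊎ IsWallOf m T i v)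
        × (∀ (D : PathDecomposition (cycleSubgraph C ∩ tileSubgraph m T i)) →
             ∀ a b c → a ≢ b → a ≢ c → b ≢ c →
             NonDegenerate (PathDecomposition.path D a) →
             NonDegenerate (PathDecomposition.path D b) →
             NonDegenerate (PathDecomposition.path D c) → ⊥)
        × (∀ (D : PathDecomposition (cycleSubgraph C ∩ tileSubgraph m T i)) →
             ∀ a b → a ≢ b →
             NonDegenerate (PathDecomposition.path D a) →
             NonDegenerate (PathDecomposition.path D b) →
             ∀ c → NonDegenerate (PathDecomposition.path D c)))
lemma6 m m≥2 T C = SameSubgraph-⋃-∩-tiles m T (cycleSubgraph C) , λ i →
    cycle∩tile-decomposition m m≥2 T C i
  , degree-two-or-wall m m≥2 T C i
  , (λ D a b c a≢b a≢c b≢c a-nondeg b-nondeg _ → no-third-path m m≥2 T C i D a b c a≢b a≢c b≢c a-nondeg b-nondeg)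
  , two-paths⇒all-NonDegenerate m m≥2 T C i
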